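{- Let $\underline D=(D,\le,0,1,+,\cdot,C,\widehat C,\ll)$ be an EDC-lattice and $\Gamma$ a prime filter of $D$, with $\overline\Gamma=D\setminus\Gamma$. Then: (1) $\{x\in D:\exists y\in\Gamma\ (\text{not } xCy)\}$ is an ideal; (2) $\{x\in D:\exists y\in\overline\Gamma\ (\text{not } x\widehat Cy)\}$ is a filter; (3) $\{x\in D:\exists y\in\overline\Gamma\ (x\ll y)\}$ is an ideal; (4) $\{x\in D:\exists y\in\Gamma\ (y\ll x)\}$ is a filter.
   Context: An EDC-lattice is a structure $(D,\le,0,1,+,\cdot,C,\widehat C,\ll)$ where $(D,\le,0,1,+,\cdot)$ is a bounded distributive lattice and $C,\widehat C,\ll$ are binary relations on $D$ such that for all $a,a',b,b',c,d\in D$ (writing $\overline R$ for the complement of a relation $R$): (C1) $aCb\Rightarrow a\neq0,b\ne 0$; (C2) $aCb$, $a\le a'$, $b\le b'\Rightarrow a'Cb'$; (C3) $aC(b+c)\Rightarrow aCb$ or $aCc$; (C4) $aCb\Rightarrow bCa$; (C5) $a\cdot b\ne0\Rightarrow aCb$; ($\widehat C$1) $a\widehat Cb\Rightarrow a\ne1,b\ne1$; ($\widehat C$2) $a\widehat Cb$, $a'\le a$, $b'\le b\Rightarrow a'\widehat Cb'$; ($\widehat C$3) $a\widehat C(b\cdot c)\Rightarrow a\widehat Cb$ or $a\widehat Cc$; ($\widehat C$4) $a\widehat Cb\Rightarrow b\widehat Ca$; ($\widehat C$5) $a+b\ne1\Rightarrow a\widehat Cb$; ($\ll$1) $0\ll0$;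 ($\ll$2) $1\ll1$; ($\ll$3) $a\ll b\Rightarrow a\le b$; ($\ll$4) $a'\le a\ll b\le b'\Rightarrow a'\ll b'$; ($\ll$5) $a\ll c$, $b\ll c\Rightarrow a+b\ll c$; ($\ll$6) $c\ll a$, $c\ll b\Rightarrow c\ll a\cdot b$; ($\ll$7) $a\ll b$, $b\cdot c\ll d$, $c\ll a+d\Rightarrow c\ll d$; (MC1) $aCb$, $a\ll c\Rightarrow aC(b\cdot c)$; (MC2) $a\overline C(b\cdot c)$, $aCb$, $(a\cdot d)\overline Cb\Rightarrow d\widehat Cc$; (M$\widehat C$1) $a\widehat Cb$, $c\ll a\Rightarrow a\widehat C(b+c)$; (M$\widehat C$2) $a\overline{\widehat C}(b+c)$, $a\widehat Cb$, $(a+d)\overline{\widehat C}b\Rightarrow dCc$; (M$\ll$1) $a\overline{\widehat C}b$, $a\cdot c\ll b\Rightarrow c\ll b$; (M$\ll$2) $a\overline Cb$, $b\ll a+c\Rightarrow b\ll c$. A filter contains $1$, is upward closed and closed under $\cdot$; it is prime if $0\notin\Gamma$ and $a+b\in\Gamma\Rightarrow a\in\Gamma$ or $b\in\Gamma$. An ideal contains $0$, is downward closed and closed under $+$. -}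

module Defs where

open import Level using (Level; suc; _⊔_)
open import Data.Product using (Σ; _×_; _,_)
open import Data.Sum using (_⊎_)
open import Relation.Nullary using (¬_)
open import Relation.Binary.PropositionalEquality using (_≡_; _≢_)
open import Relation.Binary.Structures using (IsEquivalence)
open import Algebra.Core using (Op₂)
import Algebra.Definitions as AD
import Algebra.Lattice.Structures as ALS

-- An EDC-lattice (D, ≤, 0, 1, +, ·, C, Ĉ, ≪).
-- (D, ≤, 0, 1, +, ·) is a bounded distributive lattice: + is join, · is meet,
-- equality is propositional, ≤ is the lattice order (a ≤ b iff a + b ≡ b),
-- 0 is the bottom (identity of +) and 1 the top (identity of ·).
record EDCLattice (c ℓ : Level) : Set (suc (c ⊔ ℓ)) where
  infixl 6 _+_
  infixl 7 _·_
  infix 4 _≤_ _C_ _Ĉ_ _≪_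
  field
    D   : Set c
    _+_ : Op₂ D
    _·_ : Op₂ D
    𝟘  : D
    𝟙  : D
    isDistributiveLattice : ALS.IsDistributiveLattice {A = D} _≡_ _+_ _·_
    +-identity : AD.Identity {A = D} _≡_ 𝟘 _+_
    ·-identity : AD.Identity {A = D} _≡_ 𝟙 _·_
    _C_ : D → D → Set ℓ
    _Ĉ_ : D → D → Set ℓ
    _≪_ : D → D → Set ℓ

  _≤_ : D → D → Set c
  a ≤ b = a + b ≡ b

  field
    C1 : ∀ {a b} → a C b → (a ≢ 𝟘) × (b ≢ 𝟘)
    C2 : ∀ {a a' b b'} → a C b → a ≤ a' → b ≤ b' → a' C b'
    C3 : ∀ {a b c} → a C (b + c) → (a C b) ⊎ (a C c)
    C4 : ∀ {a b} → a C b → b C a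
    C5 : ∀ {a b} → a · b ≢ 𝟘 → a C b
    Ĉ1 : ∀ {a b} → a Ĉ b → (a ≢ 𝟙) × (b ≢ 𝟙)
    Ĉ2 : ∀ {a a' b b'} → a Ĉ b → a' ≤ a → b' ≤ b → a' Ĉ b'
    Ĉ3 : ∀ {a b c} → a Ĉ (b · c) → (a Ĉ b) ⊎ (a Ĉ c)
    Ĉ4 : ∀ {a b} → a Ĉ b → b Ĉ a
    Ĉ5 : ∀ {a b} → a + b ≢ 𝟙 → a Ĉ b
    ≪1 : 𝟘 ≪ 𝟘
    ≪2 : 𝟙 ≪ 𝟙
    ≪3 : ∀ {a b} → a ≪ b → a ≤ b
    ≪4 : ∀ {a a' b b'} → a' ≤ a → a ≪ b → b ≤ b' → a' ≪ b'
    ≪5 : ∀ {a b c} → a ≪ c → b ≪ c → a + b ≪ c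
    ≪6 : ∀ {a b c} → c ≪ a → c ≪ b → c ≪ a · b
    ≪7 : ∀ {a b c d} → a ≪ b → b · c ≪ d → c ≪ a + d → c ≪ d
    MC1 : ∀ {a b c} → a C b → a ≪ c → a C (b · c)
    MC2 : ∀ {a b c d} → ¬ (a C (b · c)) → a C b → ¬ ((a · d) C b) → d Ĉ c
    MĈ1 : ∀ {a b c} → a Ĉ b → c ≪ a → a Ĉ (b + c)
    MĈ2 : ∀ {a b c d} → ¬ (a Ĉ (b + c)) → a Ĉ b → ¬ ((a + d) Ĉ b) → d C c
    M≪1 : ∀ {a b c} → ¬ (a Ĉ b) → a · c ≪ b → c ≪ b
    M≪2 : ∀ {a b c} → ¬ (a C b) → b ≪ a + c → b ≪ c

module _ {c ℓ : Level} (L : EDCLattice c ℓ) where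
  open EDCLattice L

  IsFilter : ∀ {p} → (D → Set p) → Set (c ⊔ p)
  IsFilter Γ = Γ 𝟙 × (∀ {a b} → Γ a → a ≤ b → Γ b) × (∀ {a b} → Γ a → Γ b → Γ (a · b))

  IsIdeal : ∀ {p} → (D → Set p) → Set (c ⊔ p)
  IsIdeal I = I 𝟘 × (∀ {a b} → I b → a ≤ b → I a) × (∀ {a b} → I a → I b → I (a + b))

  IsPrimeFilter : ∀ {p} → (D → Set p) → Set (c ⊔ p)
  IsPrimeFilter Γ = IsFilter Γ × ¬ Γ 𝟘 × (∀ {a b} → Γ (a + b) → Γ a ⊎ Γ b)

-- The complement of a prime filter is an ideal, so the four sets come from two dual
-- constructions applied to the filter Γ or to the ideal ∁ Γ. Each is closed under
-- + (resp. ·) because the meet of two filter witnesses (resp. the join of two ideal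
-- witnesses) is again a witness, by C3, Ĉ3, ≪5, ≪6 and the monotonicity axioms.
module Submission where

open import Defs
open import Level using (Level; _⊔_)
open import Data.Product using (Σ; _×_; _,_; proj₁)
open import Data.Sum using ([_,_])
open import Relation.Nullary using (¬_)
open import Relation.Unary using (∁)
open import Relation.Binary.PropositionalEquality using (refl; sym; trans; cong)
open import Algebra.Lattice.Bundles using (Lattice)
import Algebra.Lattice.Properties.Lattice as LatticeProperties
import Algebra.Lattice.Structures as ALS

module EDCLatticeProperties {c ℓ : Level} (L : EDCLattice c ℓ) where
  open EDCLattice L
  open ALS.IsDistributiveLattice isDistributiveLattice
    using (isLattice; ∨-comm; ∨-assoc; ∧-comm; ∨-absorbs-∧)

  lattice : Lattice c c
  lattice = record { isLattice = isLattice }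

  open LatticeProperties lattice using (∨-idem)

  ≤-refl : ∀ x → x ≤ x
  ≤-refl = ∨-idem

  x≤x+y : ∀ x y → x ≤ x + y
  x≤x+y x y = trans (sym (∨-assoc x x y)) (cong (_+ y) (∨-idem x))

  y≤x+y : ∀ x y → y ≤ x + y
  y≤x+y x y = trans (cong (y +_) (∨-comm x y)) (trans (x≤x+y y x) (∨-comm y x))

  x·y≤x : ∀ x y → x · y ≤ x
  x·y≤x x y = trans (∨-comm (x · y) x) (∨-absorbs-∧ x y)

  x·y≤y : ∀ x y → x · y ≤ y
  x·y≤y x y = trans (cong (_+ y) (∧-comm x y)) (x·y≤x y x)

  primeFilter⇒∁-isIdeal : ∀ {p} {Γ : D → Set p} → IsPrimeFilter L Γ → IsIdeal L (∁ Γ)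
  primeFilter⇒∁-isIdeal ((_ , Γ-up , _) , Γ∌𝟘 , Γ-prime) =
    Γ∌𝟘 , (λ b∉Γ a≤b a∈Γ → b∉Γ (Γ-up a∈Γ a≤b)) ,
    λ a∉Γ b∉Γ a+b∈Γ → [ a∉Γ , b∉Γ ] (Γ-prime a+b∈Γ)

  C-apart : ∀ {p} → (D → Set p) → D → Set (c ⊔ ℓ ⊔ p)
  C-apart F x = Σ D λ y → F y × ¬ (x C y)

  Ĉ-apart : ∀ {p} → (D → Set p) → D → Set (c ⊔ ℓ ⊔ p)
  Ĉ-apart I x = Σ D λ y → I y × ¬ (x Ĉ y)

  ≪-below : ∀ {p} → (D → Set p) → D → Set (c ⊔ ℓ ⊔ p)
  ≪-below I x = Σ D λ y → I y × (x ≪ y)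

  ≪-above : ∀ {p} → (D → Set p) → D → Set (c ⊔ ℓ ⊔ p)
  ≪-above F x = Σ D λ y → F y × (y ≪ x)

  filter⇒C-apart-isIdeal : ∀ {p} {F : D → Set p} → IsFilter L F → IsIdeal L (C-apart F)
  filter⇒C-apart-isIdeal (F𝟙 , _ , F-·) =
    (𝟙 , F𝟙 , λ 𝟘C𝟙 → proj₁ (C1 𝟘C𝟙) refl) ,
    (λ { (y , Fy , ¬bCy) a≤b → y , Fy , λ aCy → ¬bCy (C2 aCy a≤b (≤-refl y)) }) ,
    λ { {a} {b} (y₁ , Fy₁ , ¬aCy₁) (y₂ , Fy₂ , ¬bCy₂) →
          y₁ · y₂ , F-· Fy₁ Fy₂ ,
          λ a+bCy → [ (λ y₁·y₂Ca → ¬aCy₁ (C2 (C4 y₁·y₂Ca) (≤-refl a) (x·y≤x y₁ y₂)))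
                    , (λ y₁·y₂Cb → ¬bCy₂ (C2 (C4 y₁·y₂Cb) (≤-refl b) (x·y≤y y₁ y₂))) ]
                    (C3 (C4 a+bCy)) }

  ideal⇒Ĉ-apart-isFilter : ∀ {p} {I : D → Set p} → IsIdeal L I → IsFilter L (Ĉ-apart I)
  ideal⇒Ĉ-apart-isFilter (I𝟘 , _ , I-+) =
    (𝟘 , I𝟘 , λ 𝟙Ĉ𝟘 → proj₁ (Ĉ1 𝟙Ĉ𝟘) refl) ,
    (λ { (y , Iy , ¬aĈy) a≤b → y , Iy , λ bĈy → ¬aĈy (Ĉ2 bĈy a≤b (≤-refl y)) }) ,
    λ { {a} {b} (y₁ , Iy₁ , ¬aĈy₁) (y₂ , Iy₂ , ¬bĈy₂) →
          y₁ + y₂ , I-+ Iy₁ Iy₂ ,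
          λ a·bĈy → [ (λ y₁+y₂Ĉa → ¬aĈy₁ (Ĉ2 (Ĉ4 y₁+y₂Ĉa) (≤-refl a) (x≤x+y y₁ y₂)))
                    , (λ y₁+y₂Ĉb → ¬bĈy₂ (Ĉ2 (Ĉ4 y₁+y₂Ĉb) (≤-refl b) (y≤x+y y₁ y₂))) ]
                    (Ĉ3 (Ĉ4 a·bĈy)) }

  ideal⇒≪-below-isIdeal : ∀ {p} {I : D → Set p} → IsIdeal L I → IsIdeal L (≪-below I)
  ideal⇒≪-below-isIdeal (I𝟘 , _ , I-+) =
    (𝟘 , I𝟘 , ≪1) ,
    (λ { (y , Iy , b≪y) a≤b → y , Iy , ≪4 a≤b b≪y (≤-refl y) }) ,
    λ { {a} {b} (y₁ , Iy₁ , a≪y₁) (y₂ , Iy₂ , b≪y₂) →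
          y₁ + y₂ , I-+ Iy₁ Iy₂ ,
          ≪5 (≪4 (≤-refl a) a≪y₁ (x≤x+y y₁ y₂)) (≪4 (≤-refl b) b≪y₂ (y≤x+y y₁ y₂)) }

  filter⇒≪-above-isFilter : ∀ {p} {F : D → Set p} → IsFilter L F → IsFilter L (≪-above F)
  filter⇒≪-above-isFilter (F𝟙 , _ , F-·) =
    (𝟙 , F𝟙 , ≪2) ,
    (λ { (y , Fy , y≪a) a≤b → y , Fy , ≪4 (≤-refl y) y≪a a≤b }) ,
    λ { {a} {b} (y₁ , Fy₁ , y₁≪a) (y₂ , Fy₂ , y₂≪b) →
          y₁ · y₂ , F-· Fy₁ Fy₂ ,
          ≪6 (≪4 (x·y≤x y₁ y₂) y₁≪a (≤-refl a)) (≪4 (x·y≤y y₁ y₂) y₂≪b (≤-refl b)) }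

mainTheorem18 : ∀ {c ℓ p} (L : EDCLattice c ℓ) (Γ : EDCLattice.D L → Set p) →
    IsPrimeFilter L Γ →
    let open EDCLattice L in
    IsIdeal L (λ x → Σ D λ y → Γ y × ¬ (x C y))
    × IsFilter L (λ x → Σ D λ y → ¬ Γ y × ¬ (x Ĉ y))
    × IsIdeal L (λ x → Σ D λ y → ¬ Γ y × (x ≪ y))
    × IsFilter L (λ x → Σ D λ y → Γ y × (y ≪ x))
mainTheorem18 L Γ Γ-prime@(Γ-filter , _) =
    filter⇒C-apart-isIdeal Γ-filter
  , ideal⇒Ĉ-apart-isFilter ∁Γ-ideal
  , ideal⇒≪-below-isIdeal ∁Γ-ideal
  , filter⇒≪-above-isFilter Γ-filter
  where
  open EDCLatticeProperties L
  ∁Γ-ideal : IsIdeal L (∁ Γ)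
  ∁Γ-ideal = primeFilter⇒∁-isIdeal Γ-prime
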